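{- Let $G$ be a number all of whose options are numbers. Then $G\mathbin{:}1\triangleq\{G\mid R(G)\}$ and $G\mathbin{:}(-1)\triangleq\{L(G)\mid G\}$, where $1\cong\{0\mid\}$ and $-1\cong\{\mid 0\}$ are in canonical form.
   Context: Games are short normal-play combinatorial games $G\cong\{L(G)\mid R(G)\}$ ($\cong$ = identical literal form), $0\cong\{\mid\}$. Disjunctive sum, negation, order and equality are the usual ones. A game $G$ is a number if all its options are numbers and $G^L<G^R$ for all Left options $G^L$ and Right options $G^R$. The ordinal sum is $G\mathbin{:}H\cong\{L(G),\,G\mathbin{:}H^L\mid R(G),\,G\mathbin{:}H^R\}$. $G\triangleq H$ (equivalence modulo domination) means that in $G+(-H)$, for every first move by either player in either summand, the other player has a winning response made in the other summand. -}

module Defs where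

open import Data.List using (List; []; _∷_; _++_)
open import Data.List.Relation.Unary.All using (All)
open import Data.List.Relation.Unary.Any using (Any)
open import Data.Product using (_×_; _,_)
open import Data.Sum using (_⊎_)
open import Data.Unit using (⊤)
open import Data.Empty using (⊥)
open import Relation.Nullary using (¬_)

-- Short games in literal form  {L(G) | R(G)}  (≅ is Agda's ≡ on this type).
data Game : Set where
  ⟨_∣_⟩ : List Game → List Game → Game

L : Game → List Game
L ⟨ l ∣ r ⟩ = l

R : Game → List Game
R ⟨ l ∣ r ⟩ = r

𝟎 : Game
𝟎 = ⟨ [] ∣ [] ⟩

𝟏 : Game
𝟏 = ⟨ 𝟎 ∷ [] ∣ [] ⟩

-𝟏 : Game
-𝟏 = ⟨ [] ∣ 𝟎 ∷ [] ⟩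

mutual
  -_ : Game → Game
  - ⟨ l ∣ r ⟩ = ⟨ negs r ∣ negs l ⟩

  negs : List Game → List Game
  negs [] = []
  negs (g ∷ gs) = (- g) ∷ negs gs

mutual
  _+_ : Game → Game → Game
  ⟨ gl ∣ gr ⟩ + ⟨ hl ∣ hr ⟩ =
    ⟨ addL gl ⟨ hl ∣ hr ⟩ ++ addR ⟨ gl ∣ gr ⟩ hl
    ∣ addL gr ⟨ hl ∣ hr ⟩ ++ addR ⟨ gl ∣ gr ⟩ hr ⟩

  addL : List Game → Game → List Game
  addL [] h = []
  addL (x ∷ xs) h = (x + h) ∷ addL xs h

  addR : Game → List Game → List Game
  addR g [] = []
  addR g (y ∷ ys) = (g + y) ∷ addR g ys

-- Outcomes: G ≥ 0 iff Left wins G when Right moves first (Right has no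
-- winning move), G ≤ 0 iff Right wins G when Left moves first.
mutual
  Ge0 : Game → Set
  Ge0 ⟨ l ∣ r ⟩ = allRightAnswered r

  allRightAnswered : List Game → Set
  allRightAnswered [] = ⊤
  allRightAnswered (⟨ l ∣ r ⟩ ∷ gs) = someLeftGe0 l × allRightAnswered gs

  someLeftGe0 : List Game → Set
  someLeftGe0 [] = ⊥
  someLeftGe0 (g ∷ gs) = Ge0 g ⊎ someLeftGe0 gs

mutual
  Le0 : Game → Set
  Le0 ⟨ l ∣ r ⟩ = allLeftAnswered l

  allLeftAnswered : List Game → Set
  allLeftAnswered [] = ⊤
  allLeftAnswered (⟨ l ∣ r ⟩ ∷ gs) = someRightLe0 r × allLeftAnswered gs

  someRightLe0 : List Game → Set
  someRightLe0 [] = ⊥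
  someRightLe0 (g ∷ gs) = Le0 g ⊎ someRightLe0 gs

_≤G_ : Game → Game → Set
g ≤G h = Ge0 (h + (- g))

_<G_ : Game → Game → Set
g <G h = (g ≤G h) × ¬ (h ≤G g)

mutual
  IsNumber : Game → Set
  IsNumber ⟨ l ∣ r ⟩ =
    AllNumber l × AllNumber r × All (λ gl → All (λ gr → gl <G gr) r) l

  AllNumber : List Game → Set
  AllNumber [] = ⊤
  AllNumber (g ∷ gs) = IsNumber g × AllNumber gs

mutual
  _∶_ : Game → Game → Game
  g ∶ ⟨ l ∣ r ⟩ = ⟨ L g ++ ords g l ∣ R g ++ ords g r ⟩

  ords : Game → List Game → List Game
  ords g [] = []
  ords g (h ∷ hs) = (g ∶ h) ∷ ords g hs

-- Equivalence modulo domination, literally: in D = G + (-H), for every first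
-- move by either player in either summand, the other player has a winning
-- response in the other summand (a winning response for Right leaves a
-- position ≤ 0, i.e. Right wins with Left to move; for Left, ≥ 0).
_≜_ : Game → Game → Set
g ≜ h =
    All (λ gl → Any (λ x → Le0 (gl + x)) (R (- h))) (L g)
  ×
    All (λ x → Any (λ gr → Le0 (gr + x)) (R g)) (L (- h))
  ×
    All (λ gr → Any (λ x → Ge0 (gr + x)) (L (- h))) (R g)
  ×
    All (λ x → Any (λ gl → Ge0 (gl + x)) (L g)) (R (- h))

-- Since G:0 = G, the ordinal sum G:1 is {L(G), G | R(G)}, which differs from
-- {G | R(G)} only by the Left options of G.  In the difference game every
-- move is answered by its mirror image in the other component, except a Left
-- move to G^L, which Right answers by moving to -G; this wins because G^L ≤ G
-- when G is a number.  That inequality holds by induction: Left's only other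
-- threat, the move to G^L - G^R, loses because G^L < G^R.  The case G:(-1)
-- is dual, except that there Left must win G^R - G^L moving first, while
-- G^L < G^R only says that G^L - G^R is not ≥ 0; the comparison of the two
-- readings of the order (≤′⇒≤G) bridges the gap.
module Submission where

open import Defs
open import Data.List using (List; []; _∷_; _++_; map)
open import Data.List.Properties using (++-identityʳ)
open import Data.List.Relation.Unary.All as All using (All; []; _∷_)
import Data.List.Relation.Unary.All.Properties as All
open import Data.List.Relation.Unary.Any using (Any; here; there)
import Data.List.Relation.Unary.Any.Properties as Any
open import Data.List.Membership.Propositional using (_∈_; lose)
open import Data.List.Membership.Propositional.Properties using (∈-map⁺; ∈-++⁺ˡ; ∈-++⁺ʳ)
open import Data.Product using (_×_; _,_; proj₁; proj₂)
open import Data.Sum using (_⊎_; inj₁; inj₂; [_,_]′; swap)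
import Data.Sum as Sum
open import Data.Unit using (tt)
open import Data.Empty using (⊥-elim)
open import Function using (_∘_; id)
open import Level using (0ℓ)
open import Induction.WellFounded using (Acc; acc; WellFounded)
import Induction.WellFounded as WF
open import Relation.Binary.Construct.Closure.Transitive using (TransClosure; [_])
import Relation.Binary.Construct.Closure.Transitive as TC
open import Relation.Nullary using (¬_)
open import Relation.Binary.PropositionalEquality using (_≡_; refl; sym; cong; cong₂; subst)

private
  variable
    A : Set
    P Q : A → Set
    g : Game
    xs l r : List A

Any-rec∈ : {B : Set} → (∀ {x} → x ∈ xs → P x → B) → Any P xs → B
Any-rec∈ k (here p)  = k (here refl) p
Any-rec∈ k (there p) = Any-rec∈ (k ∘ there) p

All⊎Any : ∀ xs → (∀ {x} → x ∈ xs → P x ⊎ Q x) → All P xs ⊎ Any Q xs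
All⊎Any []       f = inj₁ []
All⊎Any (x ∷ xs) f with f (here refl) | All⊎Any xs (f ∘ there)
... | inj₂ q | _       = inj₂ (here q)
... | inj₁ p | inj₁ ps = inj₁ (p ∷ ps)
... | inj₁ p | inj₂ qs = inj₂ (there qs)

addL≡map : ∀ xs h → addL xs h ≡ map (_+ h) xs
addL≡map []       h = refl
addL≡map (x ∷ xs) h = cong (x + h ∷_) (addL≡map xs h)

addR≡map : ∀ g ys → addR g ys ≡ map (g +_) ys
addR≡map g []       = refl
addR≡map g (y ∷ ys) = cong (g + y ∷_) (addR≡map g ys)

negs≡map : ∀ xs → negs xs ≡ map -_ xs
negs≡map []       = refl
negs≡map (x ∷ xs) = cong (- x ∷_) (negs≡map xs)

L-+ : ∀ g h → L (g + h) ≡ map (_+ h) (L g) ++ map (g +_) (L h)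
L-+ ⟨ l ∣ _ ⟩ h@(⟨ l′ ∣ _ ⟩) = cong₂ _++_ (addL≡map l h) (addR≡map _ l′)

R-+ : ∀ g h → R (g + h) ≡ map (_+ h) (R g) ++ map (g +_) (R h)
R-+ ⟨ _ ∣ r ⟩ h@(⟨ _ ∣ r′ ⟩) = cong₂ _++_ (addL≡map r h) (addR≡map _ r′)

L-neg : ∀ g → L (- g) ≡ map -_ (R g)
L-neg ⟨ _ ∣ r ⟩ = negs≡map r

R-neg : ∀ g → R (- g) ≡ map -_ (L g)
R-neg ⟨ l ∣ _ ⟩ = negs≡map l

∈-L-+ˡ : ∀ {a} g h → a ∈ L g → a + h ∈ L (g + h)
∈-L-+ˡ g h a∈ = subst (_ ∈_) (sym (L-+ g h)) (∈-++⁺ˡ (∈-map⁺ (_+ h) a∈))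

∈-L-+ʳ : ∀ {b} g h → b ∈ L h → g + b ∈ L (g + h)
∈-L-+ʳ g h b∈ = subst (_ ∈_) (sym (L-+ g h)) (∈-++⁺ʳ _ (∈-map⁺ (g +_) b∈))

∈-R-+ˡ : ∀ {a} g h → a ∈ R g → a + h ∈ R (g + h)
∈-R-+ˡ g h a∈ = subst (_ ∈_) (sym (R-+ g h)) (∈-++⁺ˡ (∈-map⁺ (_+ h) a∈))

∈-R-+ʳ : ∀ {b} g h → b ∈ R h → g + b ∈ R (g + h)
∈-R-+ʳ g h b∈ = subst (_ ∈_) (sym (R-+ g h)) (∈-++⁺ʳ _ (∈-map⁺ (g +_) b∈))

∈-L-neg : ∀ {a} g → a ∈ R g → - a ∈ L (- g)
∈-L-neg g a∈ = subst (_ ∈_) (sym (L-neg g)) (∈-map⁺ -_ a∈)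

∈-R-neg : ∀ {a} g → a ∈ L g → - a ∈ R (- g)
∈-R-neg g a∈ = subst (_ ∈_) (sym (R-neg g)) (∈-map⁺ -_ a∈)

All-L-+⁺ : ∀ {P : Game → Set} g h →
  All (P ∘ (_+ h)) (L g) → All (P ∘ (g +_)) (L h) → All P (L (g + h))
All-L-+⁺ {P} g h p q = subst (All P) (sym (L-+ g h)) (All.++⁺ (All.map⁺ p) (All.map⁺ q))

All-R-+⁺ : ∀ {P : Game → Set} g h →
  All (P ∘ (_+ h)) (R g) → All (P ∘ (g +_)) (R h) → All P (R (g + h))
All-R-+⁺ {P} g h p q = subst (All P) (sym (R-+ g h)) (All.++⁺ (All.map⁺ p) (All.map⁺ q))

All-L-+⁻ : ∀ {P : Game → Set} g h →
  All P (L (g + h)) → All (P ∘ (_+ h)) (L g) × All (P ∘ (g +_)) (L h)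
All-L-+⁻ {P} g h p
  with p₁ , p₂ ← All.++⁻ (map (_+ h) (L g)) (subst (All P) (L-+ g h) p)
  = All.map⁻ p₁ , All.map⁻ p₂

All-L-neg⁺ : ∀ {P : Game → Set} g → All (P ∘ -_) (R g) → All P (L (- g))
All-L-neg⁺ {P} g p = subst (All P) (sym (L-neg g)) (All.map⁺ p)

All-R-neg⁺ : ∀ {P : Game → Set} g → All (P ∘ -_) (L g) → All P (R (- g))
All-R-neg⁺ {P} g p = subst (All P) (sym (R-neg g)) (All.map⁺ p)

All-L-neg⁻ : ∀ {P : Game → Set} g → All P (L (- g)) → All (P ∘ -_) (R g)
All-L-neg⁻ {P} g p = All.map⁻ (subst (All P) (L-neg g) p)

Any-R-+⁻ : ∀ {P : Game → Set} g h →
  Any P (R (g + h)) → Any (P ∘ (_+ h)) (R g) ⊎ Any (P ∘ (g +_)) (R h)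
Any-R-+⁻ {P} g h p =
  Sum.map Any.map⁻ Any.map⁻ (Any.++⁻ (map (_+ h) (R g)) (subst (Any P) (R-+ g h) p))

Any-R-neg⁻ : ∀ {P : Game → Set} g → Any P (R (- g)) → Any (P ∘ -_) (L g)
Any-R-neg⁻ {P} g p = Any.map⁻ (subst (Any P) (R-neg g) p)

someLeftGe0⁺ : Any Ge0 xs → someLeftGe0 xs
someLeftGe0⁺ (here p)  = inj₁ p
someLeftGe0⁺ (there p) = inj₂ (someLeftGe0⁺ p)

someRightLe0⁺ : Any Le0 xs → someRightLe0 xs
someRightLe0⁺ (here p)  = inj₁ p
someRightLe0⁺ (there p) = inj₂ (someRightLe0⁺ p)

someRightLe0⁻ : ∀ xs → someRightLe0 xs → Any Le0 xs
someRightLe0⁻ (_ ∷ _)  (inj₁ p) = here p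
someRightLe0⁻ (_ ∷ xs) (inj₂ p) = there (someRightLe0⁻ xs p)

allRightAnswered⁺ : All (Any Ge0 ∘ L) xs → allRightAnswered xs
allRightAnswered⁺ {xs = []}            []       = tt
allRightAnswered⁺ {xs = ⟨ _ ∣ _ ⟩ ∷ _} (p ∷ ps) = someLeftGe0⁺ p , allRightAnswered⁺ ps

allLeftAnswered⁺ : All (Any Le0 ∘ R) xs → allLeftAnswered xs
allLeftAnswered⁺ {xs = []}            []       = tt
allLeftAnswered⁺ {xs = ⟨ _ ∣ _ ⟩ ∷ _} (p ∷ ps) = someRightLe0⁺ p , allLeftAnswered⁺ ps

allLeftAnswered⁻ : ∀ xs → allLeftAnswered xs → All (Any Le0 ∘ R) xs
allLeftAnswered⁻ []                 tt       = []
allLeftAnswered⁻ (⟨ _ ∣ r ⟩ ∷ xs) (p , ps) = someRightLe0⁻ r p ∷ allLeftAnswered⁻ xs ps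

Ge0⁺ : ∀ g → All (Any Ge0 ∘ L) (R g) → Ge0 g
Ge0⁺ ⟨ _ ∣ _ ⟩ = allRightAnswered⁺

Le0⁺ : ∀ g → All (Any Le0 ∘ R) (L g) → Le0 g
Le0⁺ ⟨ _ ∣ _ ⟩ = allLeftAnswered⁺

Le0⁻ : ∀ g → Le0 g → All (Any Le0 ∘ R) (L g)
Le0⁻ ⟨ l ∣ _ ⟩ = allLeftAnswered⁻ l

data _◁_ : Game → Game → Set where
  left  : ∀ {x g} → x ∈ L g → x ◁ g
  right : ∀ {x g} → x ∈ R g → x ◁ g

mutual
  ◁-wellFounded : WellFounded _◁_
  ◁-wellFounded ⟨ l ∣ r ⟩ = acc λ where
    (left x∈)  → All.lookup (accessible l) x∈
    (right x∈) → All.lookup (accessible r) x∈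

  accessible : ∀ xs → All (Acc _◁_) xs
  accessible []       = []
  accessible (x ∷ xs) = ◁-wellFounded x ∷ accessible xs

open WF.All ◁-wellFounded 0ℓ using (wfRec)

_◁⁺_ : Game → Game → Set
_◁⁺_ = TransClosure _◁_

◁⁺-wellFounded : WellFounded _◁⁺_
◁⁺-wellFounded = TC.wellFounded _◁_ ◁-wellFounded

determinacy : ∀ g → (Ge0 g ⊎ Any Le0 (R g)) × (Le0 g ⊎ Any Ge0 (L g))
determinacy = wfRec _ λ g rec →
    Sum.map₁ (Ge0⁺ g) (All⊎Any (R g) (swap ∘ proj₂ ∘ rec ∘ right))
  , Sum.map₁ (Le0⁺ g) (All⊎Any (L g) (swap ∘ proj₁ ∘ rec ∘ left))

¬Ge0⇒rightWins : ∀ g → ¬ Ge0 g → Any Le0 (R g)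
¬Ge0⇒rightWins g ¬p = [ ⊥-elim ∘ ¬p , id ]′ (proj₁ (determinacy g))

¬Le0⇒leftWins : ∀ g → ¬ Le0 g → Any Ge0 (L g)
¬Le0⇒leftWins g ¬p = [ ⊥-elim ∘ ¬p , id ]′ (proj₂ (determinacy g))

_≤′_ : Game → Game → Set
g ≤′ h = Le0 (g + (- h))

≤G-refl : ∀ g → g ≤G g
≤G-refl = wfRec _ λ g rec → Ge0⁺ (g + (- g)) (All-R-+⁺ g (- g)
  (All.tabulate λ {a} a∈ → lose (∈-L-+ʳ a (- g) (∈-L-neg g a∈)) (rec (right a∈)))
  (All-R-neg⁺ g (All.tabulate λ {b} b∈ → lose (∈-L-+ˡ g (- b) b∈) (rec (left b∈)))))

≤′-refl : ∀ g → g ≤′ g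
≤′-refl = wfRec _ λ g rec → Le0⁺ (g + (- g)) (All-L-+⁺ g (- g)
  (All.tabulate λ {a} a∈ → lose (∈-R-+ʳ a (- g) (∈-R-neg g a∈)) (rec (left a∈)))
  (All-L-neg⁺ g (All.tabulate λ {b} b∈ → lose (∈-R-+ˡ g (- b) b∈) (rec (right b∈)))))

≤′⇒≤G : ∀ g h → g ≤′ h → g ≤G h
≤′⇒≤G g h = go (◁⁺-wellFounded g) (◁⁺-wellFounded h)
  where
  -- Right's winning answers in g - h may lie two levels down in g or in h.
  go : ∀ {g h} → Acc _◁⁺_ g → Acc _◁⁺_ h → g ≤′ h → g ≤G h
  go {g} {h} (acc below-g) (acc below-h) g≤′h = Ge0⁺ (h + (- g)) (All-R-+⁺ h (- g)
      (All.tabulate answerInH) (All-R-neg⁺ g (All.tabulate answerInG)))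
    where
    rightAnswers : All (λ b → Any Le0 (R (b + (- h)))) (L g)
                 × All (λ y → Any Le0 (R (g + y))) (L (- h))
    rightAnswers = All-L-+⁻ g (- h) (Le0⁻ (g + (- h)) g≤′h)

    answerInH : ∀ {a} → a ∈ R h → Any Ge0 (L (a + (- g)))
    answerInH {a} a∈ = [ Any-rec∈ (λ e∈ e≤′a → lose (∈-L-+ʳ a (- g) (∈-L-neg g e∈))
                                    (go (below-g [ right e∈ ]) (below-h [ right a∈ ]) e≤′a))
                       , Any-rec∈ (λ c∈ g≤′c → lose (∈-L-+ˡ a (- g) c∈)
                                    (go (acc below-g) (below-h (left c∈ TC.∷ [ right a∈ ])) g≤′c))
                         ∘ Any-R-neg⁻ a
                       ]′ (Any-R-+⁻ g (- a) (All.lookup (All-L-neg⁻ h (proj₂ rightAnswers)) a∈))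

    answerInG : ∀ {b} → b ∈ L g → Any Ge0 (L (h + (- b)))
    answerInG {b} b∈ = [ Any-rec∈ (λ e∈ e≤′h → lose (∈-L-+ʳ h (- b) (∈-L-neg b e∈))
                                    (go (below-g (right e∈ TC.∷ [ left b∈ ])) (acc below-h) e≤′h))
                       , Any-rec∈ (λ c∈ b≤′c → lose (∈-L-+ˡ h (- b) c∈)
                                    (go (below-g [ left b∈ ]) (below-h [ left c∈ ]) b≤′c))
                         ∘ Any-R-neg⁻ h
                       ]′ (Any-R-+⁻ b (- h) (All.lookup (proj₁ rightAnswers) b∈))

AllNumber⇒All : ∀ xs → AllNumber xs → All IsNumber xs
AllNumber⇒All []       tt       = []
AllNumber⇒All (x ∷ xs) (n , ns) = n ∷ AllNumber⇒All xs ns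

IsNumber-L : ∀ g → IsNumber g → All IsNumber (L g)
IsNumber-L ⟨ l ∣ _ ⟩ (nl , _ , _) = AllNumber⇒All l nl

IsNumber-R : ∀ g → IsNumber g → All IsNumber (R g)
IsNumber-R ⟨ _ ∣ r ⟩ (_ , nr , _) = AllNumber⇒All r nr

IsNumber-< : ∀ g → IsNumber g → ∀ {a b} → a ∈ L g → b ∈ R g → a <G b
IsNumber-< ⟨ _ ∣ _ ⟩ (_ , _ , l<r) a∈ b∈ = All.lookup (All.lookup l<r a∈) b∈

leftOption≤′number : ∀ g → IsNumber g → All (_≤′ g) (L g)
leftOption≤′number = wfRec _ λ g rec ng → All.tabulate λ {a} a∈ →
  let a≥leftOptions = rec (left a∈) (All.lookup (IsNumber-L g ng) a∈) in
  Le0⁺ (a + (- g)) (All-L-+⁺ a (- g)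
    (All.tabulate λ {c} c∈ → lose (∈-R-+ʳ c (- g) (∈-R-neg g a∈)) (All.lookup a≥leftOptions c∈))
    (All-L-neg⁺ g (All.tabulate λ {d} d∈ →
      ¬Ge0⇒rightWins (a + (- d)) (proj₂ (IsNumber-< g ng a∈ d∈)))))

number≤rightOption : ∀ g → IsNumber g → All (g ≤G_) (R g)
number≤rightOption = wfRec _ λ g rec ng → All.tabulate λ {a} a∈ →
  let a≤rightOptions = rec (right a∈) (All.lookup (IsNumber-R g ng) a∈) in
  Ge0⁺ (a + (- g)) (All-R-+⁺ a (- g)
    (All.tabulate λ {c} c∈ → lose (∈-L-+ʳ c (- g) (∈-L-neg g a∈)) (All.lookup a≤rightOptions c∈))
    (All-R-neg⁺ g (All.tabulate λ {d} d∈ →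
      ¬Le0⇒leftWins (a + (- d)) (proj₂ (IsNumber-< g ng d∈ a∈) ∘ ≤′⇒≤G a d))))

copycat : ∀ (P : Game → Set) → (∀ g → P (g + (- g))) →
  ∀ xs → All (λ x → Any (λ y → P (x + y)) (negs xs)) xs
copycat P P-refl []       = []
copycat P P-refl (x ∷ xs) = here (P-refl x) ∷ All.map there (copycat P P-refl xs)

copycat′ : ∀ (P : Game → Set) → (∀ g → P (g + (- g))) →
  ∀ xs → All (λ y → Any (λ x → P (x + y)) xs) (negs xs)
copycat′ P P-refl []       = []
copycat′ P P-refl (x ∷ xs) = here (P-refl x) ∷ All.map there (copycat′ P P-refl xs)

≜-dropDominatedLeft : All (_≤′ g) l → ⟨ l ++ g ∷ [] ∣ r ⟩ ≜ ⟨ g ∷ [] ∣ r ⟩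
≜-dropDominatedLeft {g} {l} {r} l≤′g =
    All.++⁺ (All.map here l≤′g) (here (≤′-refl g) ∷ [])
  , copycat′ Le0 ≤′-refl r
  , copycat Ge0 ≤G-refl r
  , Any.++⁺ʳ l (here (≤G-refl g)) ∷ []

≜-dropDominatedRight : All (g ≤G_) r → ⟨ l ∣ r ++ g ∷ [] ⟩ ≜ ⟨ l ∣ g ∷ [] ⟩
≜-dropDominatedRight {g} {r} {l} g≤r =
    copycat Le0 ≤′-refl l
  , Any.++⁺ʳ r (here (≤′-refl g)) ∷ []
  , All.++⁺ (All.map here g≤r) (here (≤G-refl g) ∷ [])
  , copycat′ Ge0 ≤G-refl l

∶-identityʳ : ∀ g → g ∶ 𝟎 ≡ g
∶-identityʳ ⟨ l ∣ r ⟩ = cong₂ ⟨_∣_⟩ (++-identityʳ l) (++-identityʳ r)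

∶𝟏≡ : ∀ g → g ∶ 𝟏 ≡ ⟨ L g ++ g ∷ [] ∣ R g ⟩
∶𝟏≡ g = cong₂ (λ x r → ⟨ L g ++ x ∷ [] ∣ r ⟩) (∶-identityʳ g) (++-identityʳ (R g))

∶-𝟏≡ : ∀ g → g ∶ -𝟏 ≡ ⟨ L g ∣ R g ++ g ∷ [] ⟩
∶-𝟏≡ g = cong₂ (λ l x → ⟨ l ∣ R g ++ x ∷ [] ⟩) (++-identityʳ (L g)) (∶-identityʳ g)

corollary2p7 : (G : Game) → IsNumber G →
    ((G ∶ 𝟏) ≜ ⟨ G ∷ [] ∣ R G ⟩) × ((G ∶ -𝟏) ≜ ⟨ L G ∣ G ∷ [] ⟩)
corollary2p7 G nG =
    subst (_≜ ⟨ G ∷ [] ∣ R G ⟩) (sym (∶𝟏≡ G)) (≜-dropDominatedLeft (leftOption≤′number G nG))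
  , subst (_≜ ⟨ L G ∣ G ∷ [] ⟩) (sym (∶-𝟏≡ G)) (≜-dropDominatedRight (number≤rightOption G nG))
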